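{- If $e:[\forall\underline{x}.]\ \underline{A}\Rightarrow B$ is derivable given axioms $\Phi$, then either $e$ is a proof-term constant or $e$ is beta-normalizable to a term of the form $\lambda\underline{a}.n$, where $n$ is a first-order normal proof term.
   Context: First-order terms $t ::= x \mid f(t_1,\dots,t_n)$; atomic formulas $P(t_1,\dots,t_n)$; Horn formulas $F ::= [\forall \underline{x}].\ A_1,\dots,A_n \Rightarrow A$ ($n\ge0$), where $\forall\underline{x}.F$ quantifies all free term variables of $F$ and $[\forall\underline{x}].F$ means $F$ or $\forall\underline{x}.F$; $\underline{A}$ abbreviates a list $A_1,\dots,A_n$. Proof terms $p,e ::= \kappa \mid a \mid \lambda a.e \mid e\ e'$ ($\kappa$ proof-term constants, $a$ proof-term variables); beta-reduction is the congruence closure of $(\lambda a.p)p'\to_\beta[p'/a]p$. A proof term is first-order if it is built from proof-term variables and constants by application only. A logic program $\Phi$ is a list of closed Horn formulas labelled by distinct proof-term constants. Typing $e:F$ given $\Phi$ is generated by: (axiom) $\kappa:\forall\underline{x}.F$ if $(\kappa:\forall\underline{x}.F)\in\Phi$; (gen) from $e:F$ infer $e:\forall\underline{x}.F$; (inst) from $e:\forall\underline{x}.F$ infer $e:[\underline{t}/\underline{x}]F$; (cut) from $e_1:\underline{A}\Rightarrow D$ and $e_2:\underline{B},D\Rightarrow C$ infer $\lambda\underline{a}.\lambda\underline{b}.(e_2\ \underline{b})\ (e_1\ \underline{a}) : \underline{A},\underline{B}\Rightarrow C$, where $\underline{a},\underline{b}$ are lists of fresh proof-term variables of the lengths of $\underline{A},\underline{B}$,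 $\lambda\underline{a}.t=\lambda a_1.\cdots\lambda a_n.t$ and $t\ \underline{b}=(\dots(t\ b_1)\dots b_n)$. -}

module Defs where

open import Data.Nat using (ℕ; zero; suc; _+_; _<ᵇ_; compare; less; equal; greater)
open import Data.Bool using (if_then_else_)
open import Data.List using (List; []; _∷_; _++_; length; map; foldl)
open import Data.Product using (_×_; _,_; ∃; ∃-syntax)
open import Data.List.Membership.Propositional using (_∈_)
open import Relation.Nullary using (¬_)
open import Relation.Binary.Construct.Closure.ReflexiveTransitive using (Star)

data Term : Set where
  var : ℕ → Term
  fn  : ℕ → List Term → Term

mutual
  substT : (ℕ → Term) → Term → Term
  substT σ (var x)   = σ x
  substT σ (fn f ts) = fn f (substTs σ ts)

  substTs : (ℕ → Term) → List Term → List Term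
  substTs σ []       = []
  substTs σ (t ∷ ts) = substT σ t ∷ substTs σ ts

data Atom : Set where
  atom : ℕ → List Term → Atom

substA : (ℕ → Term) → Atom → Atom
substA σ (atom P ts) = atom P (substTs σ ts)

record Horn : Set where
  constructor _⇒_
  field
    body : List Atom
    head : Atom

substH : (ℕ → Term) → Horn → Horn
substH σ (As ⇒ A) = map (substA σ) As ⇒ substA σ A

-- plain H  is  H ;  ∀' H  is  ∀x̲. H  (quantifying all free term variables of H)
data Form : Set where
  plain : Horn → Form
  ∀'    : Horn → Form

-- Proof terms (de Bruijn indices for proof-term variables)

data PT : Set where
  con : ℕ → PT
  var : ℕ → PT
  lam : PT → PT
  app : PT → PT → PT

shift : ℕ → ℕ → PT → PT
shift c d (con k)   = con k
shift c d (var x)   = if x <ᵇ c then var x else var (x + d)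
shift c d (lam t)   = lam (shift (suc c) d t)
shift c d (app t u) = app (shift c d t) (shift c d u)

-- sub j s t : substitute s for variable j in t, removing the binder
sub : ℕ → PT → PT → PT
sub j s (con k)   = con k
sub j s (var x) with compare x j
... | less .x _    = var x
... | equal .x     = shift 0 j s
... | greater .j k = var (j + k)
sub j s (lam t)   = lam (sub (suc j) s t)
sub j s (app t u) = app (sub j s t) (sub j s u)

infix 4 _→β_
data _→β_ : PT → PT → Set where
  β     : ∀ {t s} → app (lam t) s →β sub 0 s t
  ξlam  : ∀ {t t'} → t →β t' → lam t →β lam t'
  ξappₗ : ∀ {t t' u} → t →β t' → app t u →β app t' u
  ξappᵣ : ∀ {t u u'} → u →β u' → app t u →β app t u'

infix 4 _→β*_
_→β*_ : PT → PT → Set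
_→β*_ = Star _→β_

Normal : PT → Set
Normal t = ∀ t' → ¬ (t →β t')

data FirstOrder : PT → Set where
  con : ∀ k → FirstOrder (con k)
  var : ∀ x → FirstOrder (var x)
  app : ∀ {t u} → FirstOrder t → FirstOrder u → FirstOrder (app t u)

lams : ℕ → PT → PT
lams zero    t = t
lams (suc k) t = lam (lams k t)

apps : PT → List PT → PT
apps = foldl app

vars : ℕ → ℕ → List PT
vars off zero    = []
vars off (suc k) = var (off + k) ∷ vars off k

-- λa̲.λb̲.(e₂ b̲)(e₁ a̲) with |a̲| = n, |b̲| = m
cutTerm : ℕ → ℕ → PT → PT → PT
cutTerm n m e₁ e₂ =
  lams (n + m) (app (apps (shift 0 (n + m) e₂) (vars 0 m))
                    (apps (shift 0 (n + m) e₁) (vars m n)))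

-- entry (κ , A̲ , B) stands for  κ : ∀x̲. A̲ ⇒ B
Program : Set
Program = List (ℕ × List Atom × Atom)

data _⊢_∶_ (Φ : Program) : PT → Form → Set where
  axiom : ∀ {κ As B} → (κ , As , B) ∈ Φ → Φ ⊢ con κ ∶ ∀' (As ⇒ B)
  gen   : ∀ {e H} → Φ ⊢ e ∶ plain H → Φ ⊢ e ∶ ∀' H
  inst  : ∀ {e H} (σ : ℕ → Term) → Φ ⊢ e ∶ ∀' H → Φ ⊢ e ∶ plain (substH σ H)
  cut   : ∀ {e₁ e₂ As Bs D C} →
          Φ ⊢ e₁ ∶ plain (As ⇒ D) →
          Φ ⊢ e₂ ∶ plain ((Bs ++ D ∷ []) ⇒ C) →
          Φ ⊢ cutTerm (length As) (length Bs) e₁ e₂ ∶ plain ((As ++ Bs) ⇒ C)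

module Submission where

-- Induction on the typing derivation: every typable term is closed and is either a constant
-- or β-reduces to λⁿ. N with N first-order, n being the number of premises of its type.
-- Closedness makes the shifts in a cut term vanish; applying the two cut premises to
-- variables then contracts their leading λs by substituting first-order terms into
-- first-order terms, and at most one further redex (the head applied to the argument) is
-- left, whose contraction stays first-order too. First-order terms have no λ, hence no redex.

open import Defs
open import Data.Nat using (ℕ; zero; suc; _+_; _<_; _≤_; _<ᵇ_; z≤n; s≤s; compare; less; equal; greater)
open import Data.Nat.Properties using (<⇒<ᵇ; <-≤-trans; ≤-trans; +-suc; +-identityʳ; +-comm; ≤-reflexive; m≤n+m; +-monoʳ-<; +-monoʳ-≤; n<1+n; n≤1+n)
open import Data.Bool using (true; false)
open import Data.List using (List; []; _∷_; length; map)
open import Data.List.Properties using (length-++; length-map)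
open import Data.List.Relation.Unary.All using (All; []; _∷_)
open import Data.List.Relation.Unary.Unique.Propositional using (Unique)
open import Data.Product using (_×_; _,_; proj₁; ∃; ∃-syntax)
open import Data.Sum using (_⊎_; inj₁; inj₂; [_,_]′; reduce)
open import Relation.Binary.PropositionalEquality using (_≡_; refl; subst; cong; cong₂)
open import Relation.Binary.Construct.Closure.ReflexiveTransitive using (ε; _◅_; _◅◅_; gmap)

data Scoped (c : ℕ) : PT → Set where
  con : ∀ k → Scoped c (con k)
  var : ∀ {x} → x < c → Scoped c (var x)
  lam : ∀ {t} → Scoped (suc c) t → Scoped c (lam t)
  app : ∀ {t u} → Scoped c t → Scoped c u → Scoped c (app t u)

shift-scoped : ∀ {c} d {t} → Scoped c t → shift c d t ≡ t
shift-scoped d (con k) = refl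
shift-scoped {c} d (var {x} x<c) with x <ᵇ c | <⇒<ᵇ x<c
... | true | _ = refl
shift-scoped d (lam s) = cong lam (shift-scoped d s)
shift-scoped d (app s s′) = cong₂ app (shift-scoped d s) (shift-scoped d s′)

scoped-weaken : ∀ {c c′ t} → c ≤ c′ → Scoped c t → Scoped c′ t
scoped-weaken le (con k) = con k
scoped-weaken le (var x<c) = var (<-≤-trans x<c le)
scoped-weaken le (lam s) = lam (scoped-weaken (s≤s le) s)
scoped-weaken le (app s s′) = app (scoped-weaken le s) (scoped-weaken le s′)

lams-scoped : ∀ k {c t} → Scoped (c + k) t → Scoped c (lams k t)
lams-scoped zero {c} {t} s = subst (λ c′ → Scoped c′ t) (+-identityʳ c) s
lams-scoped (suc k) {c} {t} s = lam (lams-scoped k (subst (λ c′ → Scoped c′ t) (+-suc c k) s))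

apps-scoped : ∀ {c t xs} → Scoped c t → All (Scoped c) xs → Scoped c (apps t xs)
apps-scoped s [] = s
apps-scoped s (sx ∷ sxs) = apps-scoped (app s sx) sxs

vars-scoped : ∀ off k {c} → off + k ≤ c → All (Scoped c) (vars off k)
vars-scoped off zero le = []
vars-scoped off (suc k) le =
  var (<-≤-trans (+-monoʳ-< off (n<1+n k)) le) ∷ vars-scoped off k (≤-trans (+-monoʳ-≤ off (n≤1+n k)) le)

ξappₗ* : ∀ {t t′ u} → t →β* t′ → app t u →β* app t′ u
ξappₗ* = gmap _ ξappₗ

ξappᵣ* : ∀ {t u u′} → u →β* u′ → app t u →β* app t u′
ξappᵣ* = gmap _ ξappᵣ

ξlams* : ∀ k {t t′} → t →β* t′ → lams k t →β* lams k t′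
ξlams* zero r = r
ξlams* (suc k) r = gmap lam ξlam (ξlams* k r)

ξapps* : ∀ xs {t t′} → t →β* t′ → apps t xs →β* apps t′ xs
ξapps* [] r = r
ξapps* (x ∷ xs) r = ξapps* xs (ξappₗ* r)

shift-firstOrder : ∀ c d {t} → FirstOrder t → FirstOrder (shift c d t)
shift-firstOrder c d (con k) = con k
shift-firstOrder c d (var x) with x <ᵇ c
... | true = var x
... | false = var _
shift-firstOrder c d (app f f′) = app (shift-firstOrder c d f) (shift-firstOrder c d f′)

sub-firstOrder : ∀ j {s t} → FirstOrder s → FirstOrder t → FirstOrder (sub j s t)
sub-firstOrder j fs (con k) = con k
sub-firstOrder j fs (var x) with compare x j
... | less .x _ = var x
... | equal .x = shift-firstOrder 0 j fs
... | greater .j k = var _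
sub-firstOrder j fs (app f f′) = app (sub-firstOrder j fs f) (sub-firstOrder j fs f′)

apps-firstOrder : ∀ {t xs} → FirstOrder t → All FirstOrder xs → FirstOrder (apps t xs)
apps-firstOrder f [] = f
apps-firstOrder f (fx ∷ fxs) = apps-firstOrder (app f fx) fxs

vars-firstOrder : ∀ off k → All FirstOrder (vars off k)
vars-firstOrder off zero = []
vars-firstOrder off (suc k) = var _ ∷ vars-firstOrder off k

length-vars : ∀ off k → length (vars off k) ≡ k
length-vars off zero = refl
length-vars off (suc k) = cong suc (length-vars off k)

firstOrder⇒normal : ∀ {t} → FirstOrder t → Normal t
firstOrder⇒normal (app () _) _ β
firstOrder⇒normal (app f _) _ (ξappₗ r) = firstOrder⇒normal f _ r
firstOrder⇒normal (app _ f′) _ (ξappᵣ r) = firstOrder⇒normal f′ _ r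

sub-lams : ∀ k j s t → sub j s (lams k t) ≡ lams k (sub (k + j) s t)
sub-lams zero j s t = refl
sub-lams (suc k) j s t rewrite sub-lams k (suc j) s t | +-suc k j = refl

β-lams : ∀ k {s t} → app (lam (lams k t)) s →β lams k (sub (k + 0) s t)
β-lams k {s} {t} = subst (app (lam (lams k t)) s →β_) (sub-lams k 0 s t) β

lams-apps-↠ : ∀ k {xs N} → All FirstOrder xs → FirstOrder N →
  ∃[ N′ ] (apps (lams (length xs + k) N) xs →β* lams k N′) × FirstOrder N′
lams-apps-↠ k [] fN = _ , ε , fN
lams-apps-↠ k {x ∷ xs} (fx ∷ fxs) fN =
  let N′ , r , fN′ = lams-apps-↠ k fxs (sub-firstOrder (length xs + k + 0) fx fN)
  in N′ , ξapps* xs (β-lams (length xs + k) ◅ ε) ◅◅ r , fN′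

data Canonical (k : ℕ) : PT → Set where
  con     : ∀ κ → Canonical k (con κ)
  reduces : ∀ {e N} → e →β* lams k N → FirstOrder N → Canonical k e

FirstOrderNormalisable : PT → Set
FirstOrderNormalisable e = ∃[ N ] (e →β* N) × FirstOrder N

canonical-apps : ∀ k {e xs} → Canonical (length xs + k) e → All FirstOrder xs →
  FirstOrderNormalisable (apps e xs) ⊎ (∃[ N ] (apps e xs →β* lams k N) × FirstOrder N)
canonical-apps k (con κ) fxs = inj₁ (_ , ε , apps-firstOrder (con κ) fxs)
canonical-apps k {xs = xs} (reduces r fN) fxs =
  let N′ , r′ , fN′ = lams-apps-↠ k fxs fN in inj₂ (N′ , ξapps* xs r ◅◅ r′ , fN′)

cutBody : ℕ → ℕ → PT → PT → PT
cutBody n m e₁ e₂ = app (apps e₂ (vars 0 m)) (apps e₁ (vars m n))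

cutTerm-closed : ∀ n m {e₁ e₂} → Scoped 0 e₁ → Scoped 0 e₂ →
  cutTerm n m e₁ e₂ ≡ lams (n + m) (cutBody n m e₁ e₂)
cutTerm-closed n m s₁ s₂ rewrite shift-scoped (n + m) s₁ | shift-scoped (n + m) s₂ = refl

cutTerm-scoped : ∀ n m {e₁ e₂} → Scoped 0 e₁ → Scoped 0 e₂ → Scoped 0 (cutTerm n m e₁ e₂)
cutTerm-scoped n m s₁ s₂ rewrite cutTerm-closed n m s₁ s₂ =
  lams-scoped (n + m) (app
    (apps-scoped (scoped-weaken z≤n s₂) (vars-scoped 0 m (m≤n+m m n)))
    (apps-scoped (scoped-weaken z≤n s₁) (vars-scoped m n (≤-reflexive (+-comm m n)))))

app-normalisable : ∀ {f a} →
  FirstOrderNormalisable f ⊎ (∃[ N ] (f →β* lam N) × FirstOrder N) →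
  FirstOrderNormalisable a → FirstOrderNormalisable (app f a)
app-normalisable (inj₁ (F , rF , fF)) (A , rA , fA) = app F A , ξappₗ* rF ◅◅ ξappᵣ* rA , app fF fA
app-normalisable (inj₂ (N , rN , fN)) (A , rA , fA) =
  sub 0 A N , ξappₗ* rN ◅◅ ξappᵣ* rA ◅◅ β ◅ ε , sub-firstOrder 0 fA fN

cutBody-normalisable : ∀ n m {e₁ e₂} → Canonical n e₁ → Canonical (m + 1) e₂ →
  FirstOrderNormalisable (cutBody n m e₁ e₂)
cutBody-normalisable n m {e₁} {e₂} c₁ c₂ =
  app-normalisable (canonical-apps 1 c₂′ (vars-firstOrder 0 m))
                   (reduce (canonical-apps 0 c₁′ (vars-firstOrder m n)))
  where
  c₁′ : Canonical (length (vars m n) + 0) e₁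
  c₁′ rewrite length-vars m n | +-identityʳ n = c₁
  c₂′ : Canonical (length (vars 0 m) + 1) e₂
  c₂′ rewrite length-vars 0 m = c₂

canonical-cut : ∀ n m {e₁ e₂} → Scoped 0 e₁ → Scoped 0 e₂ →
  Canonical n e₁ → Canonical (m + 1) e₂ → Canonical (n + m) (cutTerm n m e₁ e₂)
canonical-cut n m s₁ s₂ c₁ c₂ rewrite cutTerm-closed n m s₁ s₂ =
  let B , r , fB = cutBody-normalisable n m c₁ c₂ in reduces (ξlams* (n + m) r) fB

arity : Form → ℕ
arity (plain H) = length (Horn.body H)
arity (∀' H)    = length (Horn.body H)

module _ {Φ : Program} where

  typed⇒closed : ∀ {e F} → Φ ⊢ e ∶ F → Scoped 0 e
  typed⇒closed (axiom _)   = con _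
  typed⇒closed (gen d)     = typed⇒closed d
  typed⇒closed (inst _ d)  = typed⇒closed d
  typed⇒closed (cut {As = As} {Bs} d₁ d₂) =
    cutTerm-scoped (length As) (length Bs) (typed⇒closed d₁) (typed⇒closed d₂)

  typed⇒canonical : ∀ {e F} → Φ ⊢ e ∶ F → Canonical (arity F) e
  typed⇒canonical (axiom _) = con _
  typed⇒canonical (gen d)   = typed⇒canonical d
  typed⇒canonical (inst {H = As ⇒ _} σ d) rewrite length-map (substA σ) As = typed⇒canonical d
  typed⇒canonical (cut {As = As} {Bs} d₁ d₂) rewrite length-++ As {Bs} =
    canonical-cut (length As) (length Bs) (typed⇒closed d₁) (typed⇒closed d₂)
      (typed⇒canonical d₁) (subst (λ k → Canonical k _) (length-++ Bs) (typed⇒canonical d₂))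

-- The labels need not be distinct: the argument never looks up an axiom by its label.
lemma2 : (Φ : Program) → Unique (map proj₁ Φ) →
    (e : PT) (As : List Atom) (B : Atom) →
    (Φ ⊢ e ∶ plain (As ⇒ B)) ⊎ (Φ ⊢ e ∶ ∀' (As ⇒ B)) →
    (∃[ κ ] e ≡ con κ) ⊎
    (∃[ k ] ∃[ n ] (e →β* lams k n) × FirstOrder n × Normal n)
lemma2 Φ _ e As B d with [ typed⇒canonical , typed⇒canonical ]′ d
... | con κ        = inj₁ (κ , refl)
... | reduces r fN = inj₂ (length As , _ , r , fN , firstOrder⇒normal fN)
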